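{- Let $G=(V,E)$ be an undirected, connected, simple graph with $n=|V|\ge 2$ vertices, adjacency matrix $A$, degree matrix $D=\mathrm{diag}(d_u)_{u\in V}$ and Laplacian $L=D-A$. For $s,t\in V$ let $b(s,t)=(\mathbf e_s-\mathbf e_t)^{\top}(L^{\dagger})^2(\mathbf e_s-\mathbf e_t)$, where $L^\dagger$ is the Moore–Penrose pseudoinverse of $L$. Fix any vertex $v\in V$ and let $L_v$ be the principal submatrix of $L$ obtained by deleting the row and column of $v$ (so $L_v$ is invertible). For $s,t\in V$, let $\mathbf x\in\mathbb R^{V\setminus\{v\}}$ be the vector $\mathbf e_s-\mathbf e_t$ with its $v$-th coordinate deleted, and let $\mathbf 1$ be the all-ones vector in $\mathbb R^{V\setminus\{v\}}$. Then $$b(s,t)=\big\|L_v^{ -1}\mathbf x\big\|_2^2-\frac1n\big(\mathbf 1^{\top}L_v^{ -1}\mathbf x\big)^2=\big\|\tilde{\boldsymbol\tau}^{(v)}_s-\tilde{\boldsymbol\tau}^{(v)}_t\big\|_2^2-\frac1n\Big(\mathbf 1^{\top}\big(\tilde{\boldsymbol\tau}^{(v)}_s-\tilde{\boldsymbol\tau}^{(v)}_t\big)\Big)^2 .$$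
   Context: The simple random walk on $G$ moves from its current vertex $x$ to a uniformly random neighbor of $x$ (transition matrix $P=D^{ -1}A$). A $v$-absorbed random walk started at $s$ is the simple random walk $X_0=s,X_1,\dots$ stopped at the first time $T_v=\min\{k\ge 0: X_k=v\}$. For $s\in V$, $\tilde{\boldsymbol\tau}^{(v)}_s\in\mathbb R^{V\setminus\{v\}}$ is the degree-normalized expected visit-count vector: its entry at $u\neq v$ is $\frac{1}{d_u}\,\mathbb E\big[\#\{k: 0\le k<T_v,\ X_k=u\}\mid X_0=s\big]$ (in particular it is the zero vector if $s=v$). -}

module Defs where

open import Data.Nat using (ℕ; zero; suc; _≤_)
open import Data.Integer using (+_)
open import Data.Rational using (ℚ; 0ℚ; 1ℚ; _+_; _*_; _-_; _/_; ∣_∣; _<_)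
open import Data.Fin using (Fin; zero; suc; punchIn; _≟_)
open import Data.Bool using (Bool; true; false; if_then_else_)
open import Data.Product using (∃-syntax)
open import Relation.Binary.PropositionalEquality using (_≡_)
open import Relation.Nullary using (¬_; yes; no)
open import Function using (_∘_)

Σℚ : ∀ {k} → (Fin k → ℚ) → ℚ
Σℚ {zero}  f = 0ℚ
Σℚ {suc k} f = f zero + Σℚ (f ∘ suc)

Σℕ : ∀ {k} → (Fin k → ℕ) → ℕ
Σℕ {zero}  f = 0
Σℕ {suc k} f = f zero Data.Nat.+ Σℕ (f ∘ suc)

Mat : ℕ → ℕ → Set
Mat k l = Fin k → Fin l → ℚ

Vect : ℕ → Set
Vect k = Fin k → ℚ

_⊗_ : ∀ {k l p} → Mat k l → Mat l p → Mat k p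
(M ⊗ N) i j = Σℚ (λ r → M i r * N r j)

_·_ : ∀ {k l} → Mat k l → Vect l → Vect k
(M · x) i = Σℚ (λ r → M i r * x r)

_ᵀ : ∀ {k l} → Mat k l → Mat l k
(M ᵀ) i j = M j i

δ : ∀ {k} → Fin k → Fin k → ℚ
δ i j with i ≟ j
... | yes _ = 1ℚ
... | no  _ = 0ℚ

Id : ∀ {k} → Mat k k
Id = δ

ℕtoℚ : ℕ → ℚ
ℕtoℚ k = + k / 1

-- 1/k for k ≥ 1 (and 0 for k = 0; never used since degrees are ≥ 1)
recip : ℕ → ℚ
recip zero    = 0ℚ
recip (suc k) = + 1 / suc k

Adj : ℕ → Set
Adj n = Fin n → Fin n → Bool

Symmetric : ∀ {n} → Adj n → Set
Symmetric A = ∀ u w → A u w ≡ A w u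

Loopless : ∀ {n} → Adj n → Set
Loopless A = ∀ u → A u u ≡ false

data Reach {n} (A : Adj n) : Fin n → Fin n → Set where
  here : ∀ {u} → Reach A u u
  step : ∀ {u w x} → A u w ≡ true → Reach A w x → Reach A u x

Connected : ∀ {n} → Adj n → Set
Connected A = ∀ u w → Reach A u w

b2q : Bool → ℚ
b2q true  = 1ℚ
b2q false = 0ℚ

deg : ∀ {n} → Adj n → Fin n → ℕ
deg A u = Σℕ (λ w → if A u w then 1 else 0)

AdjM : ∀ {n} → Adj n → Mat n n
AdjM A u w = b2q (A u w)

DegM : ∀ {n} → Adj n → Mat n n
DegM A u w = δ u w * ℕtoℚ (deg A u)

Lap : ∀ {n} → Adj n → Mat n n
Lap A u w = DegM A u w - AdjM A u w

-- Moore–Penrose pseudoinverse: the (unique) matrix satisfying the Penrose equations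
IsPseudoInverse : ∀ {k} → Mat k k → Mat k k → Set
IsPseudoInverse M X =
  (∀ i j → (M ⊗ (X ⊗ M)) i j ≡ M i j) ×' (∀ i j → (X ⊗ (M ⊗ X)) i j ≡ X i j)
  ×' (∀ i j → ((M ⊗ X) ᵀ) i j ≡ (M ⊗ X) i j) ×' (∀ i j → ((X ⊗ M) ᵀ) i j ≡ (X ⊗ M) i j)
  where open import Data.Product renaming (_×_ to _×'_)

IsInverse : ∀ {k} → Mat k k → Mat k k → Set
IsInverse M X = (∀ i j → (M ⊗ X) i j ≡ Id i j) × (∀ i j → (X ⊗ M) i j ≡ Id i j)
  where open import Data.Product using (_×_)

eDiff : ∀ {n} → Fin n → Fin n → Vect n
eDiff s t u = δ s u - δ t u

bst : ∀ {n} → Mat n n → Fin n → Fin n → ℚ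
bst Ld s t = Σℚ (λ u → eDiff s t u * ((Ld ⊗ Ld) · eDiff s t) u)

sq : ℚ → ℚ
sq q = q * q

quadForm : ∀ {k} → ℕ → Vect k → ℚ
quadForm n y = Σℚ (λ i → sq (y i)) - recip n * sq (Σℚ y)

-- Vertex set V ∖ {v} of a graph on Fin (suc m) is indexed by Fin m via punchIn v.
-- principal submatrix L_v
delRowCol : ∀ {m} → Fin (suc m) → Mat (suc m) (suc m) → Mat m m
delRowCol v M i j = M (punchIn v i) (punchIn v j)

delCoord : ∀ {m} → Fin (suc m) → Vect (suc m) → Vect m
delCoord v x i = x (punchIn v i)

-- v-absorbed simple random walk.
-- walkDist A v s k u = P[X_k = u, k < T_v | X_0 = s], for u ≠ v (u indexed by Fin m).
walkDist : ∀ {m} → Adj (suc m) → Fin (suc m) → Fin (suc m) → ℕ → Vect m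
walkDist A v s zero    u = δ s (punchIn v u)
walkDist A v s (suc k) u =
  Σℚ (λ w → walkDist A v s k w * (b2q (A (punchIn v w) (punchIn v u)) * recip (deg A (punchIn v w))))

-- expected number of visits to u before time min(K, T_v)
partialVisits : ∀ {m} → Adj (suc m) → Fin (suc m) → Fin (suc m) → ℕ → Vect m
partialVisits A v s zero    u = 0ℚ
partialVisits A v s (suc K) u = partialVisits A v s K u + walkDist A v s K u

ConvergesTo : (ℕ → ℚ) → ℚ → Set
ConvergesTo f q = ∀ (ε : ℚ) → 0ℚ < ε → ∃[ N ] (∀ K → N ≤ K → ∣ f K - q ∣ < ε)

-- τ is the family of degree-normalised expected visit-count vectors τ̃^{(v)}_s:
-- τ s u = (1/d_u) · E[#{k < T_v : X_k = u} | X_0 = s] = (1/d_u) · Σ_k P[X_k = u, k < T_v]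
IsNormVisitVector : ∀ {m} → Adj (suc m) → Fin (suc m) → (Fin (suc m) → Vect m) → Set
IsNormVisitVector A v τ =
  ∀ s u → ConvergesTo (λ K → recip (deg A (punchIn v u)) * partialVisits A v s K u) (τ s u)

{-# OPTIONS --safe #-}
-- For x = e_s − e_t the pseudoinverse returns the zero-sum solution z of L z = x, and then
-- b(s,t) = xᵀ (L†)² x = (L z)ᵀ L† z = zᵀ (L L†) z = ‖z‖².  That solution is explicit: solve the
-- grounded system L_v y = x off v, extend y by 0 at v and subtract the mean, which gives
-- ‖z‖² = ‖y‖² − (1ᵀ y)² / n with y = L_v⁻¹ x.
-- For the walk, L_v = D_v (I − Q) with Q the substochastic transition matrix on V ∖ {v}, so the
-- degree-normalised visit counts up to time K telescope to L_v⁻¹ e_s − L_v⁻¹ μ_K, where μ_K is the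
-- distribution of the walk at time K.  By connectivity every vertex leaks mass into v within a
-- bounded number of steps, so μ_K decays geometrically; hence τ̃_s = L_v⁻¹ e_s and the second
-- formula is the first one.
module Submission where

open import Defs
open import Algebra.Bundles using (CommutativeRing)
open import Data.Nat as ℕ using (ℕ; zero; suc)
import Data.Nat.Properties as ℕₚ
import Data.Integer as ℤ
import Data.Integer.Properties as ℤₚ
import Data.Nat.Coprimality as Coprimality
open import Data.Rational as ℚ using (ℚ; mkℚ; 0ℚ; 1ℚ; _+_; _*_; _-_; -_; 1/_)
open import Data.Rational.Properties hiding (_≟_)
open import Data.Rational.Solver using (module +-*-Solver)
open import Data.Fin using (Fin; zero; suc; punchIn; punchOut; _≟_)
open import Data.Fin.Properties using (punchInᵢ≢i; punchIn-punchOut; punchIn-injective)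
open import Data.Vec.Functional using (insertAt)
open import Data.Vec.Functional.Properties using (insertAt-lookup; insertAt-punchIn; removeAt-insertAt)
open import Data.Bool using (true; false; if_then_else_)
open import Data.Product using (_×_; _,_; proj₁; proj₂; map; map₂; ∃-syntax)
open import Data.Empty using (⊥-elim)
open import Function using (_∘_; flip; const)
open import Function.Definitions using (Injective)
open import Relation.Nullary using (yes; no; Dec)
open import Relation.Binary.PropositionalEquality
open import Algebra.Properties.Semiring.Sum (CommutativeRing.semiring +-*-commutativeRing) using (sum; sum-cong-≗; sum-replicate-zero; sum-remove; ∑-distrib-+; ∑-comm; *-distribˡ-sum; *-distribʳ-sum)
open import Algebra.Properties.Group +-0-group using () renaming (x∙y⁻¹≈ε⇒x≈y to p-q≡0⇒p≡q)
open +-*-Solver using (solve; _:=_; _:+_; _:*_; _:-_; :-_; con)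
open ≡-Reasoning

-- Finite sums

Σ≡sum : ∀ {k} (f : Fin k → ℚ) → Σℚ f ≡ sum f
Σ≡sum {zero}  f = refl
Σ≡sum {suc k} f = cong (f zero +_) (Σ≡sum (f ∘ suc))

Σ-cong : ∀ {k} {f g : Fin k → ℚ} → f ≗ g → Σℚ f ≡ Σℚ g
Σ-cong {f = f} {g} f≗g = trans (Σ≡sum f) (trans (sum-cong-≗ f≗g) (sym (Σ≡sum g)))

Σ-zero : ∀ k → Σℚ {k} (const 0ℚ) ≡ 0ℚ
Σ-zero k = trans (Σ≡sum {k} (const 0ℚ)) (sum-replicate-zero k)

Σ-distrib-+ : ∀ {k} (f g : Fin k → ℚ) → Σℚ (λ i → f i + g i) ≡ Σℚ f + Σℚ g
Σ-distrib-+ f g = begin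
  Σℚ (λ i → f i + g i)  ≡⟨ Σ≡sum (λ i → f i + g i) ⟩
  sum (λ i → f i + g i) ≡⟨ ∑-distrib-+ f g ⟩
  sum f + sum g         ≡⟨ cong₂ _+_ (Σ≡sum f) (Σ≡sum g) ⟨
  Σℚ f + Σℚ g           ∎

Σ-distrib-- : ∀ {k} (f g : Fin k → ℚ) → Σℚ (λ i → f i - g i) ≡ Σℚ f - Σℚ g
Σ-distrib-- {zero}  f g = refl
Σ-distrib-- {suc k} f g = begin
  (f zero - g zero) + Σℚ (λ i → f (suc i) - g (suc i)) ≡⟨ cong ((f zero - g zero) +_) (Σ-distrib-- (f ∘ suc) (g ∘ suc)) ⟩
  (f zero - g zero) + (Σℚ (f ∘ suc) - Σℚ (g ∘ suc))
    ≡⟨ solve 4 (λ a b c d → (a :- b) :+ (c :- d) := (a :+ c) :- (b :+ d)) refl (f zero) (g zero) _ _ ⟩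
  (f zero + Σℚ (f ∘ suc)) - (g zero + Σℚ (g ∘ suc))    ∎

*-distribˡ-Σ : ∀ {k} c (f : Fin k → ℚ) → c * Σℚ f ≡ Σℚ (λ i → c * f i)
*-distribˡ-Σ c f = trans (cong (c *_) (Σ≡sum f)) (trans (*-distribˡ-sum c f) (sym (Σ≡sum (λ i → c * f i))))

*-distribʳ-Σ : ∀ {k} c (f : Fin k → ℚ) → Σℚ f * c ≡ Σℚ (λ i → f i * c)
*-distribʳ-Σ c f = trans (cong (_* c) (Σ≡sum f)) (trans (*-distribʳ-sum c f) (sym (Σ≡sum (λ i → f i * c))))

Σ-comm : ∀ {k l} (f : Fin k → Fin l → ℚ) → Σℚ (λ i → Σℚ (f i)) ≡ Σℚ (λ j → Σℚ (λ i → f i j))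
Σ-comm f = trans (Σ²≡sum² f) (trans (∑-comm f) (sym (Σ²≡sum² (flip f))))
  where
  Σ²≡sum² : ∀ {k l} (g : Fin k → Fin l → ℚ) → Σℚ (λ i → Σℚ (g i)) ≡ sum (λ i → sum (g i))
  Σ²≡sum² g = trans (Σ-cong (λ i → Σ≡sum (g i))) (Σ≡sum (λ i → sum (g i)))

Σ-punchIn : ∀ {m} (v : Fin (suc m)) (f : Fin (suc m) → ℚ) → Σℚ f ≡ f v + Σℚ (f ∘ punchIn v)
Σ-punchIn v f = trans (Σ≡sum f) (trans (sum-remove f) (cong (f v +_) (sym (Σ≡sum (f ∘ punchIn v)))))

δ-refl : ∀ {k} (i : Fin k) → δ i i ≡ 1ℚ
δ-refl i with i ≟ i
... | yes _   = refl
... | no i≢i = ⊥-elim (i≢i refl)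

δ-≢ : ∀ {k} {i j : Fin k} → i ≢ j → δ i j ≡ 0ℚ
δ-≢ {i = i} {j} i≢j with i ≟ j
... | yes i≡j = ⊥-elim (i≢j i≡j)
... | no _    = refl

δ-sym : ∀ {k} (i j : Fin k) → δ i j ≡ δ j i
δ-sym i j with i ≟ j | j ≟ i
... | yes _   | yes _   = refl
... | no _    | no _    = refl
... | yes i≡j | no j≢i  = ⊥-elim (j≢i (sym i≡j))
... | no i≢j  | yes j≡i = ⊥-elim (i≢j (sym j≡i))

δ-injective : ∀ {k l} (f : Fin k → Fin l) → Injective _≡_ _≡_ f → ∀ i j → δ (f i) (f j) ≡ δ i j
δ-injective f f-inj i j with i ≟ j
... | yes refl = δ-refl (f i)
... | no i≢j   = δ-≢ (i≢j ∘ f-inj)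

δ-weight : ∀ {k} (f : Fin k → ℚ) u w → δ u w * f u ≡ δ u w * f w
δ-weight f u w with u ≟ w
... | yes refl = refl
... | no _     = trans (*-zeroˡ (f u)) (sym (*-zeroˡ (f w)))

Σ-δˡ : ∀ {k} (i : Fin k) (f : Fin k → ℚ) → Σℚ (λ j → δ i j * f j) ≡ f i
Σ-δˡ {suc _} i f = begin
  Σℚ (λ j → δ i j * f j)                         ≡⟨ Σ-punchIn i (λ j → δ i j * f j) ⟩
  δ i i * f i + Σℚ (λ j → δ i (i′ j) * f (i′ j))
    ≡⟨ cong₂ _+_ (cong (_* f i) (δ-refl i)) (Σ-cong (λ j → cong (_* f (i′ j)) (δ-≢ (punchInᵢ≢i i j ∘ sym)))) ⟩
  1ℚ * f i + Σℚ (λ j → 0ℚ * f (i′ j))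
    ≡⟨ cong₂ _+_ (*-identityˡ (f i)) (trans (sym (*-distribˡ-Σ 0ℚ (f ∘ i′))) (*-zeroˡ (Σℚ (f ∘ i′)))) ⟩
  f i + 0ℚ                                       ≡⟨ +-identityʳ (f i) ⟩
  f i                                            ∎
  where i′ = punchIn i

Σ-δʳ : ∀ {k} (i : Fin k) (f : Fin k → ℚ) → Σℚ (λ j → f j * δ j i) ≡ f i
Σ-δʳ i f = trans (Σ-cong (λ j → trans (*-comm (f j) (δ j i)) (cong (_* f j) (δ-sym j i)))) (Σ-δˡ i f)

Σ-δ : ∀ {k} (i : Fin k) → Σℚ (δ i) ≡ 1ℚ
Σ-δ i = trans (Σ-cong (λ j → sym (*-identityʳ (δ i j)))) (Σ-δˡ i (const 1ℚ))

Σ-eDiff : ∀ {k} (s t : Fin k) → Σℚ (eDiff s t) ≡ 0ℚ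
Σ-eDiff s t = trans (Σ-distrib-- (δ s) (δ t)) (trans (cong₂ _-_ (Σ-δ s) (Σ-δ t)) (+-inverseʳ 1ℚ))

ℕtoℚ≡mkℚ : ∀ k → ℕtoℚ k ≡ mkℚ (ℤ.+ k) 0 (Coprimality.sym (Coprimality.1-coprimeTo k))
ℕtoℚ≡mkℚ k = normalize-coprime (Coprimality.sym (Coprimality.1-coprimeTo k))

ℕtoℚ-+ : ∀ a b → ℕtoℚ (a ℕ.+ b) ≡ ℕtoℚ a + ℕtoℚ b
ℕtoℚ-+ a b rewrite ℕtoℚ≡mkℚ a | ℕtoℚ≡mkℚ b =
  cong (ℚ._/ 1) (sym (cong₂ ℤ._+_ (ℤₚ.*-identityʳ (ℤ.+ a)) (ℤₚ.*-identityʳ (ℤ.+ b))))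

ℕtoℚ-Σℕ : ∀ {k} (f : Fin k → ℕ) → ℕtoℚ (Σℕ f) ≡ Σℚ (ℕtoℚ ∘ f)
ℕtoℚ-Σℕ {zero}  f = refl
ℕtoℚ-Σℕ {suc k} f = trans (ℕtoℚ-+ (f zero) (Σℕ (f ∘ suc))) (cong (ℕtoℚ (f zero) +_) (ℕtoℚ-Σℕ (f ∘ suc)))

≤-Σℕ : ∀ {k} (f : Fin k → ℕ) j → f j ℕ.≤ Σℕ f
≤-Σℕ f zero    = ℕₚ.m≤m+n (f zero) (Σℕ (f ∘ suc))
≤-Σℕ f (suc j) = ℕₚ.≤-trans (≤-Σℕ (f ∘ suc) j) (ℕₚ.m≤n+m (Σℕ (f ∘ suc)) (f zero))

Σ-const : ∀ k c → Σℚ {k} (const c) ≡ ℕtoℚ k * c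
Σ-const zero    c = sym (*-zeroˡ c)
Σ-const (suc k) c = begin
  c + Σℚ {k} (const c)  ≡⟨ cong (c +_) (Σ-const k c) ⟩
  c + ℕtoℚ k * c        ≡⟨ solve 2 (λ c K → c :+ K :* c := (con 1ℚ :+ K) :* c) refl c (ℕtoℚ k) ⟩
  (1ℚ + ℕtoℚ k) * c     ≡⟨ cong (_* c) (ℕtoℚ-+ 1 k) ⟨
  ℕtoℚ (suc k) * c      ∎

recip-inverseˡ : ∀ d .{{_ : ℕ.NonZero d}} → recip d * ℕtoℚ d ≡ 1ℚ
recip-inverseˡ (suc k) =
  trans (cong₂ _*_ (normalize-coprime (Coprimality.1-coprimeTo (suc k))) (ℕtoℚ≡mkℚ (suc k)))
        (*-inverseˡ (mkℚ (ℤ.+ suc k) 0 (Coprimality.sym (Coprimality.1-coprimeTo (suc k)))))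

constant-zeroSum : ∀ {k} {p : Vect (suc k)} {c} → (∀ u → p u ≡ c) → Σℚ p ≡ 0ℚ → c ≡ 0ℚ
constant-zeroSum {k} {p} {c} p≡c Σp≡0 = begin
  c                     ≡⟨ *-identityˡ c ⟨
  1ℚ * c                ≡⟨ cong (_* c) (recip-inverseˡ (suc k)) ⟨
  r * ℕtoℚ (suc k) * c  ≡⟨ *-assoc r (ℕtoℚ (suc k)) c ⟩
  r * (ℕtoℚ (suc k) * c) ≡⟨ cong (r *_) (trans (sym (Σ-const (suc k) c)) (trans (sym (Σ-cong p≡c)) Σp≡0)) ⟩
  r * 0ℚ                ≡⟨ *-zeroʳ r ⟩
  0ℚ                    ∎
  where r = recip (suc k)

-- Vectors and matrices

infix 7 _∙_
_∙_ : ∀ {k} → Vect k → Vect k → ℚ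
x ∙ y = Σℚ (λ i → x i * y i)

_ᵀ·_ : ∀ {k l} → Vect k → Mat k l → Vect l
(μ ᵀ· M) j = Σℚ (λ i → μ i * M i j)

SymmetricMat : ∀ {k} → Mat k k → Set
SymmetricMat M = ∀ i j → M i j ≡ M j i

ZeroRowSums : ∀ {k l} → Mat k l → Set
ZeroRowSums M = ∀ i → Σℚ (M i) ≡ 0ℚ

·-congʳ : ∀ {k l} (M : Mat k l) {x y : Vect l} → x ≗ y → M · x ≗ M · y
·-congʳ M x≗y i = Σ-cong (λ j → cong (M i j *_) (x≗y j))

·-congˡ : ∀ {k l} {M N : Mat k l} (x : Vect l) → (∀ i j → M i j ≡ N i j) → M · x ≗ N · x
·-congˡ x M≡N i = Σ-cong (λ j → cong (_* x j) (M≡N i j))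

ᵀ·-∙ : ∀ {k l} (μ : Vect k) (M : Mat k l) (g : Vect l) → (μ ᵀ· M) ∙ g ≡ μ ∙ (M · g)
ᵀ·-∙ μ M g = begin
  Σℚ (λ j → Σℚ (λ i → μ i * M i j) * g j)   ≡⟨ Σ-cong (λ j → *-distribʳ-Σ (g j) (λ i → μ i * M i j)) ⟩
  Σℚ (λ j → Σℚ (λ i → μ i * M i j * g j))   ≡⟨ Σ-comm (λ j i → μ i * M i j * g j) ⟩
  Σℚ (λ i → Σℚ (λ j → μ i * M i j * g j))   ≡⟨ Σ-cong (λ i → Σ-cong (λ j → *-assoc (μ i) (M i j) (g j))) ⟩
  Σℚ (λ i → Σℚ (λ j → μ i * (M i j * g j))) ≡⟨ Σ-cong (λ i → *-distribˡ-Σ (μ i) (λ j → M i j * g j)) ⟨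
  Σℚ (λ i → μ i * (M · g) i)                ∎

·-∙ : ∀ {k} {M : Mat k k} → SymmetricMat M → (x y : Vect k) → (M · x) ∙ y ≡ x ∙ (M · y)
·-∙ {M = M} M-sym x y = trans (Σ-cong (λ i → cong (_* y i) (M·x≗xᵀ·M i))) (ᵀ·-∙ x M y)
  where
  M·x≗xᵀ·M : M · x ≗ x ᵀ· M
  M·x≗xᵀ·M i = Σ-cong (λ j → trans (*-comm (M i j) (x j)) (cong (x j *_) (M-sym i j)))

⊗-· : ∀ {k l p} (M : Mat k l) (N : Mat l p) (x : Vect p) → (M ⊗ N) · x ≗ M · (N · x)
⊗-· M N x i = ᵀ·-∙ (M i) N x

ᵀ·-⊗ : ∀ {k l p} (μ : Vect k) (M : Mat k l) (N : Mat l p) → μ ᵀ· (M ⊗ N) ≗ (μ ᵀ· M) ᵀ· N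
ᵀ·-⊗ μ M N u = sym (ᵀ·-∙ μ M (λ j → N j u))

·-distrib-- : ∀ {k l} (M : Mat k l) (x y : Vect l) → M · (λ j → x j - y j) ≗ λ i → (M · x) i - (M · y) i
·-distrib-- M x y i = trans (Σ-cong (λ j → solve 3 (λ m a b → m :* (a :- b) := m :* a :- m :* b) refl (M i j) (x j) (y j)))
                            (Σ-distrib-- (λ j → M i j * x j) (λ j → M i j * y j))

ᵀ·-distrib-- : ∀ {k l} (μ ν : Vect k) (M : Mat k l) → (λ i → μ i - ν i) ᵀ· M ≗ λ j → (μ ᵀ· M) j - (ν ᵀ· M) j
ᵀ·-distrib-- μ ν M j = trans (Σ-cong (λ i → solve 3 (λ a b m → (a :- b) :* m := a :* m :- b :* m) refl (μ i) (ν i) (M i j)))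
                             (Σ-distrib-- (λ i → μ i * M i j) (λ i → ν i * M i j))

Id-· : ∀ {k} (x : Vect k) → Id · x ≗ x
Id-· x i = Σ-δˡ i x

ᵀ·-Id : ∀ {k} (μ : Vect k) → μ ᵀ· Id ≗ μ
ᵀ·-Id μ u = Σ-δʳ u μ

·-const : ∀ {k l} (M : Mat k l) c → M · const c ≗ λ i → Σℚ (M i) * c
·-const M c i = sym (*-distribʳ-Σ c (M i))

·-const≡0 : ∀ {k l} (M : Mat k l) → ZeroRowSums M → ∀ c → M · const c ≗ const 0ℚ
·-const≡0 M rowSums c i = trans (·-const M c i) (trans (cong (_* c) (rowSums i)) (*-zeroˡ c))

Σ-ᵀ·≡0 : ∀ {k l} (M : Mat k l) → ZeroRowSums M → ∀ μ → Σℚ (μ ᵀ· M) ≡ 0ℚ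
Σ-ᵀ·≡0 M rowSums μ = begin
  Σℚ (λ j → Σℚ (λ i → μ i * M i j)) ≡⟨ Σ-comm (λ j i → μ i * M i j) ⟩
  Σℚ (λ i → Σℚ (λ j → μ i * M i j)) ≡⟨ Σ-cong (λ i → trans (sym (*-distribˡ-Σ (μ i) (M i))) (cong (μ i *_) (rowSums i))) ⟩
  Σℚ (λ i → μ i * 0ℚ)               ≡⟨ trans (sym (*-distribʳ-Σ 0ℚ μ)) (*-zeroʳ (Σℚ μ)) ⟩
  0ℚ                                ∎

Σ-·≡0 : ∀ {k l} (M : Mat k l) → ZeroRowSums (M ᵀ) → ∀ x → Σℚ (M · x) ≡ 0ℚ
Σ-·≡0 M colSums x = trans (Σ-cong (λ i → Σ-cong (λ j → *-comm (M i j) (x j)))) (Σ-ᵀ·≡0 (M ᵀ) colSums x)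

inverse-sym : ∀ {k} {M Y : Mat k k} → SymmetricMat M → IsInverse M Y → SymmetricMat Y
inverse-sym {M = M} {Y} M-sym (MY≡I , _) i j = begin
  Y i j                       ≡⟨ Σ-δʳ i (λ k → Y k j) ⟨
  Σℚ (λ k → Y k j * δ k i)    ≡⟨ Σ-cong (λ k → trans (*-comm (Y k j) (δ k i)) (cong (_* Y k j) (sym (MY≡I k i)))) ⟩
  (M · column i) ∙ column j   ≡⟨ ·-∙ M-sym (column i) (column j) ⟩
  column i ∙ (M · column j)   ≡⟨ Σ-cong (λ k → cong (Y k i *_) (MY≡I k j)) ⟩
  Σℚ (λ k → Y k i * δ k j)    ≡⟨ Σ-δʳ j (λ k → Y k i) ⟩
  Y j i                       ∎
  where
  column : Fin _ → Vect _
  column c k = Y k c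

ZeroSumKernelTrivial : ∀ {k} → Mat k k → Set
ZeroSumKernelTrivial M = ∀ p → M · p ≗ const 0ℚ → Σℚ p ≡ 0ℚ → p ≗ const 0ℚ

module PseudoInverse {k} {M X : Mat k k} (M-sym : SymmetricMat M) (pinv : IsPseudoInverse M X) where

  MXM≡M : ∀ i j → (M ⊗ (X ⊗ M)) i j ≡ M i j
  MXM≡M = proj₁ pinv

  XM-sym : SymmetricMat (X ⊗ M)
  XM-sym i j = proj₂ (proj₂ (proj₂ pinv)) j i

  M·X·M·≗M· : ∀ y → M · (X · (M · y)) ≗ M · y
  M·X·M·≗M· y u = begin
    (M · (X · (M · y))) u  ≡⟨ ·-congʳ M (λ j → sym (⊗-· X M y j)) u ⟩
    (M · ((X ⊗ M) · y)) u  ≡⟨ ⊗-· M (X ⊗ M) y u ⟨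
    ((M ⊗ (X ⊗ M)) · y) u  ≡⟨ ·-congˡ y MXM≡M u ⟩
    (M · y) u              ∎

  pinv-solution : ZeroRowSums M → ZeroSumKernelTrivial M → ∀ {x z} → M · z ≗ x → Σℚ z ≡ 0ℚ → X · x ≗ z
  pinv-solution rowSums kernel {x} {z} Mz≗x Σz≡0 u = p-q≡0⇒p≡q _ _ (kernel residual M·residual≡0 Σresidual≡0 u)
    where
    X·x≗XM·z : X · x ≗ (X ⊗ M) · z
    X·x≗XM·z u = trans (·-congʳ X (sym ∘ Mz≗x) u) (sym (⊗-· X M z u))
    residual : Vect k
    residual u = (X · x) u - z u
    M·residual≡0 : M · residual ≗ const 0ℚ
    M·residual≡0 u = begin
      (M · residual) u             ≡⟨ ·-distrib-- M (X · x) z u ⟩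
      (M · (X · x)) u - (M · z) u  ≡⟨ cong (_- (M · z) u) (trans (·-congʳ M (·-congʳ X (sym ∘ Mz≗x)) u) (M·X·M·≗M· z u)) ⟩
      (M · z) u - (M · z) u        ≡⟨ +-inverseʳ ((M · z) u) ⟩
      0ℚ                           ∎
    XM-colSums : ZeroRowSums ((X ⊗ M) ᵀ)
    XM-colSums j = trans (Σ-cong (λ i → XM-sym i j)) (Σ-ᵀ·≡0 M rowSums (X j))
    Σresidual≡0 : Σℚ residual ≡ 0ℚ
    Σresidual≡0 = begin
      Σℚ residual        ≡⟨ Σ-distrib-- (X · x) z ⟩
      Σℚ (X · x) - Σℚ z  ≡⟨ cong₂ _-_ (trans (Σ-cong X·x≗XM·z) (Σ-·≡0 (X ⊗ M) XM-colSums z)) Σz≡0 ⟩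
      0ℚ - 0ℚ            ≡⟨ +-inverseʳ 0ℚ ⟩
      0ℚ                 ∎

  pinv-quadratic : ∀ {x y z} → M · z ≗ x → M · y ≗ z → X · x ≗ z → x ∙ ((X ⊗ X) · x) ≡ z ∙ z
  pinv-quadratic {x} {y} {z} Mz≗x My≗z Xx≗z = begin
    x ∙ ((X ⊗ X) · x)  ≡⟨ Σ-cong (λ u → cong (x u *_) (trans (⊗-· X X x u) (·-congʳ X Xx≗z u))) ⟩
    x ∙ (X · z)        ≡⟨ Σ-cong (λ u → cong (_* (X · z) u) (sym (Mz≗x u))) ⟩
    (M · z) ∙ (X · z)  ≡⟨ ·-∙ M-sym z (X · z) ⟩
    z ∙ (M · (X · z))  ≡⟨ Σ-cong (λ u → cong (z u *_) (M·X·z≗z u)) ⟩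
    z ∙ z              ∎
    where
    M·X·z≗z : M · (X · z) ≗ z
    M·X·z≗z u = trans (·-congʳ M (·-congʳ X (sym ∘ My≗z)) u) (trans (M·X·M·≗M· y u) (My≗z u))

-- Centering and deleting a vertex

center : ∀ {k} → Vect (suc k) → Vect (suc k)
center {k} p u = p u - recip (suc k) * Σℚ p

Σ-center : ∀ {k} (p : Vect (suc k)) → Σℚ (center p) ≡ 0ℚ
Σ-center {k} p = begin
  Σℚ (center p)                   ≡⟨ Σ-distrib-- p (const (r * S)) ⟩
  S - Σℚ {suc k} (const (r * S))  ≡⟨ cong (λ e → S - e) (Σ-const (suc k) (r * S)) ⟩
  S - N * (r * S)                 ≡⟨ cong (λ e → S - e) (solve 3 (λ N r S → N :* (r :* S) := (r :* N) :* S) refl N r S) ⟩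
  S - (r * N) * S                 ≡⟨ cong (λ c → S - c * S) (recip-inverseˡ (suc k)) ⟩
  S - 1ℚ * S                      ≡⟨ solve 1 (λ S → S :- con 1ℚ :* S := con 0ℚ) refl S ⟩
  0ℚ                              ∎
  where
  S = Σℚ p
  r = recip (suc k)
  N = ℕtoℚ (suc k)

center-∙ : ∀ {k} (p : Vect (suc k)) → center p ∙ center p ≡ quadForm (suc k) p
center-∙ {k} p = begin
  Σℚ (λ u → (p u - c) * (p u - c))
    ≡⟨ Σ-cong (λ u → solve 2 (λ a c → (a :- c) :* (a :- c) := (a :* a :- (c :+ c) :* a) :+ c :* c) refl (p u) c) ⟩
  Σℚ (λ u → (sq (p u) - (c + c) * p u) + c * c)  ≡⟨ Σ-distrib-+ (λ u → sq (p u) - (c + c) * p u) (const (c * c)) ⟩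
  Σℚ (λ u → sq (p u) - (c + c) * p u) + Σℚ {suc k} (const (c * c))
    ≡⟨ cong₂ _+_ (trans (Σ-distrib-- (sq ∘ p) (λ u → (c + c) * p u)) (cong (λ e → Q - e) (sym (*-distribˡ-Σ (c + c) p))))
                 (Σ-const (suc k) (c * c)) ⟩
  (Q - (c + c) * S) + N * (c * c)
    ≡⟨ solve 4 (λ Q S r N → (Q :- (r :* S :+ r :* S) :* S) :+ N :* ((r :* S) :* (r :* S))
                            := Q :- r :* (S :* S) :+ (r :* N :- con 1ℚ) :* (r :* (S :* S))) refl Q S r N ⟩
  Q - r * sq S + (r * N - 1ℚ) * (r * sq S)       ≡⟨ cong (λ e → Q - r * sq S + (e - 1ℚ) * (r * sq S)) (recip-inverseˡ (suc k)) ⟩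
  Q - r * sq S + (1ℚ - 1ℚ) * (r * sq S)          ≡⟨ solve 2 (λ a b → a :+ (con 1ℚ :- con 1ℚ) :* b := a) refl (Q - r * sq S) (r * sq S) ⟩
  Q - r * sq S                                   ∎
  where
  S = Σℚ p
  Q = Σℚ (sq ∘ p)
  r = recip (suc k)
  N = ℕtoℚ (suc k)
  c = r * S

·-center : ∀ {k l} (M : Mat l (suc k)) → ZeroRowSums M → ∀ p → M · center p ≗ M · p
·-center {k} M rowSums p i = begin
  (M · center p) i                          ≡⟨ ·-distrib-- M p (const c) i ⟩
  (M · p) i - (M · const c) i               ≡⟨ cong (λ e → (M · p) i - e) (·-const≡0 M rowSums c i) ⟩
  (M · p) i - 0ℚ                            ≡⟨ solve 1 (λ a → a :- con 0ℚ := a) refl ((M · p) i) ⟩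
  (M · p) i                                 ∎
  where c = recip (suc k) * Σℚ p

quadForm-cong : ∀ {k} n {x y : Vect k} → x ≗ y → quadForm n x ≡ quadForm n y
quadForm-cong n x≗y = cong₂ (λ a b → a - recip n * sq b) (Σ-cong (cong sq ∘ x≗y)) (Σ-cong x≗y)

punchIn-elim : ∀ {m} (v : Fin (suc m)) {P : Fin (suc m) → Set} → P v → (∀ i → P (punchIn v i)) → ∀ u → P u
punchIn-elim v {P} Pv P∘punchIn u with v ≟ u
... | yes refl = Pv
... | no v≢u   = subst P (punchIn-punchOut v≢u) (P∘punchIn (punchOut v≢u))

≗-by-delCoord-Σ : ∀ {m} (v : Fin (suc m)) {f g : Vect (suc m)} → Σℚ f ≡ Σℚ g → delCoord v f ≗ delCoord v g → f ≗ g
≗-by-delCoord-Σ v {f} {g} Σf≡Σg f≗g-off-v = punchIn-elim v f≡g-at-v f≗g-off-v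
  where
  f≡g-at-v : f v ≡ g v
  f≡g-at-v = begin
    f v                                            ≡⟨ solve 2 (λ a b → a := (a :+ b) :- b) refl (f v) _ ⟩
    (f v + Σℚ (delCoord v f)) - Σℚ (delCoord v f)
      ≡⟨ cong₂ _-_ (trans (sym (Σ-punchIn v f)) (trans Σf≡Σg (Σ-punchIn v g))) (Σ-cong f≗g-off-v) ⟩
    (g v + Σℚ (delCoord v g)) - Σℚ (delCoord v g)  ≡⟨ solve 2 (λ a b → (a :+ b) :- b := a) refl (g v) _ ⟩
    g v                                            ∎

Σ-insertAt : ∀ {m} (v : Fin (suc m)) (g : ℚ → ℚ) (c : Vect m) → Σℚ (g ∘ insertAt c v 0ℚ) ≡ g 0ℚ + Σℚ (g ∘ c)
Σ-insertAt v g c = trans (Σ-punchIn v (g ∘ insertAt c v 0ℚ))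
                         (cong₂ _+_ (cong g (insertAt-lookup c v 0ℚ)) (Σ-cong (cong g ∘ insertAt-punchIn c v 0ℚ)))

quadForm-insertAt : ∀ {m} (v : Fin (suc m)) (c : Vect m) → quadForm (suc m) (insertAt c v 0ℚ) ≡ quadForm (suc m) c
quadForm-insertAt {m} v c = cong₂ (λ a b → a - recip (suc m) * sq b)
  (trans (Σ-insertAt v sq c) (+-identityˡ (Σℚ (sq ∘ c)))) (trans (Σ-insertAt v (λ q → q) c) (+-identityˡ (Σℚ c)))

·-punchIn : ∀ {m} (v : Fin (suc m)) (M : Mat (suc m) (suc m)) (y : Vect (suc m)) → y v ≡ 0ℚ →
            ∀ i → (M · y) (punchIn v i) ≡ (delRowCol v M · delCoord v y) i
·-punchIn v M y y-v≡0 i = begin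
  (M · y) (punchIn v i)  ≡⟨ Σ-punchIn v (λ w → M (punchIn v i) w * y w) ⟩
  a * y v + rest         ≡⟨ cong (λ e → a * e + rest) y-v≡0 ⟩
  a * 0ℚ + rest          ≡⟨ solve 2 (λ a b → a :* con 0ℚ :+ b := b) refl a rest ⟩
  rest                   ∎
  where
  a = M (punchIn v i) v
  rest = (delRowCol v M · delCoord v y) i

module Estimates where

  open import Data.Rational using (_≤_; _<_; ∣_∣; _⊔_; *<*; nonNegative; positive)
  open import Data.Sum using (inj₁; inj₂)
  open import Algebra.Definitions.RawSemiring ℚ.+-*-rawSemiring using (_^_)

  0≤1 : 0ℚ ≤ 1ℚ
  0≤1 = nonNegative⁻¹ 1ℚ

  0<1 : 0ℚ < 1ℚ
  0<1 = positive⁻¹ 1ℚ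

  *-nonNeg : ∀ {a b} → 0ℚ ≤ a → 0ℚ ≤ b → 0ℚ ≤ a * b
  *-nonNeg {a} {b} 0≤a 0≤b = nonNegative⁻¹ (a * b) {{nonNeg*nonNeg⇒nonNeg a {{nonNegative 0≤a}} b {{nonNegative 0≤b}}}}

  *-monoˡ-≤ : ∀ {c a b} → 0ℚ ≤ c → a ≤ b → c * a ≤ c * b
  *-monoˡ-≤ {c} 0≤c = *-monoˡ-≤-nonNeg c {{nonNegative 0≤c}}

  *-monoʳ-≤ : ∀ {c a b} → 0ℚ ≤ c → a ≤ b → a * c ≤ b * c
  *-monoʳ-≤ {c} 0≤c = *-monoʳ-≤-nonNeg c {{nonNegative 0≤c}}

  ℕtoℚ-nonNeg : ∀ k → 0ℚ ≤ ℕtoℚ k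
  ℕtoℚ-nonNeg k = nonNegative⁻¹ (ℕtoℚ k) {{normalize-nonNeg k 1}}

  recip-nonNeg : ∀ d → 0ℚ ≤ recip d
  recip-nonNeg zero    = ≤-refl
  recip-nonNeg (suc k) = nonNegative⁻¹ (recip (suc k)) {{normalize-nonNeg 1 (suc k)}}

  recip-pos : ∀ d .{{_ : ℕ.NonZero d}} → 0ℚ < recip d
  recip-pos (suc k) = positive⁻¹ (recip (suc k)) {{normalize-pos 1 (suc k)}}

  p-q≤p : ∀ p {q} → 0ℚ ≤ q → p - q ≤ p
  p-q≤p p {q} 0≤q = subst₂ _≤_ (+-identityʳ (p - q)) (solve 2 (λ p q → (p :- q) :+ q := p) refl p q) (+-monoʳ-≤ (p - q) 0≤q)

  p-q<p : ∀ p {q} → 0ℚ < q → p - q < p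
  p-q<p p {q} 0<q = subst₂ _<_ (+-identityʳ (p - q)) (solve 2 (λ p q → (p :- q) :+ q := p) refl p q) (+-monoʳ-< (p - q) 0<q)

  b2q-nonNeg : ∀ b → 0ℚ ≤ b2q b
  b2q-nonNeg true  = 0≤1
  b2q-nonNeg false = ≤-refl

  δ-nonNeg : ∀ {k} (i j : Fin k) → 0ℚ ≤ δ i j
  δ-nonNeg i j with i ≟ j
  ... | yes _ = 0≤1
  ... | no _  = ≤-refl

  Σ-mono-≤ : ∀ {k} {f g : Fin k → ℚ} → (∀ i → f i ≤ g i) → Σℚ f ≤ Σℚ g
  Σ-mono-≤ {zero}  f≤g = ≤-refl
  Σ-mono-≤ {suc k} f≤g = +-mono-≤ (f≤g zero) (Σ-mono-≤ (f≤g ∘ suc))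

  Σ-nonNeg : ∀ {k} {f : Fin k → ℚ} → (∀ i → 0ℚ ≤ f i) → 0ℚ ≤ Σℚ f
  Σ-nonNeg {k} {f} 0≤f = subst (_≤ Σℚ f) (Σ-zero k) (Σ-mono-≤ 0≤f)

  Σ-mono-< : ∀ {k} {f g : Fin k → ℚ} → (∀ i → f i ≤ g i) → ∀ j → f j < g j → Σℚ f < Σℚ g
  Σ-mono-< {suc k} f≤g zero    fj<gj = +-mono-<-≤ fj<gj (Σ-mono-≤ (f≤g ∘ suc))
  Σ-mono-< {suc k} f≤g (suc j) fj<gj = +-mono-≤-< (f≤g zero) (Σ-mono-< (f≤g ∘ suc) j fj<gj)

  ≤-Σ : ∀ {k} {f : Fin k → ℚ} → (∀ i → 0ℚ ≤ f i) → ∀ j → f j ≤ Σℚ f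
  ≤-Σ {suc _} {f} 0≤f j = subst₂ _≤_ (+-identityʳ (f j)) (sym (Σ-punchIn j f))
                                     (+-monoʳ-≤ (f j) (Σ-nonNeg (0≤f ∘ punchIn j)))

  ∣Σ∣≤Σ∣∣ : ∀ {k} (f : Fin k → ℚ) → ∣ Σℚ f ∣ ≤ Σℚ (∣_∣ ∘ f)
  ∣Σ∣≤Σ∣∣ {zero}  f = ≤-refl
  ∣Σ∣≤Σ∣∣ {suc k} f =
    ≤-trans (∣p+q∣≤∣p∣+∣q∣ (f zero) (Σℚ (f ∘ suc))) (+-monoʳ-≤ ∣ f zero ∣ (∣Σ∣≤Σ∣∣ (f ∘ suc)))

  ∣ᵀ·∣≤ : ∀ {k l} {μ : Vect k} → (∀ i → 0ℚ ≤ μ i) → ∀ (M : Mat k l) j →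
          ∣ (μ ᵀ· M) j ∣ ≤ Σℚ μ * Σℚ (λ i → ∣ M i j ∣)
  ∣ᵀ·∣≤ {μ = μ} 0≤μ M j = ≤-trans (∣Σ∣≤Σ∣∣ (λ i → μ i * M i j))
    (subst (_≤ Σℚ μ * C) (Σ-cong (λ i → sym (∣μM∣≡μ∣M∣ i)))
      (subst (Σℚ (λ i → μ i * ∣ M i j ∣) ≤_) (sym (*-distribʳ-Σ C μ))
        (Σ-mono-≤ (λ i → *-monoˡ-≤ (0≤μ i) (≤-Σ (λ i′ → 0≤∣p∣ (M i′ j)) i)))))
    where
    C = Σℚ (λ i → ∣ M i j ∣)
    ∣μM∣≡μ∣M∣ : ∀ i → ∣ μ i * M i j ∣ ≡ μ i * ∣ M i j ∣
    ∣μM∣≡μ∣M∣ i = trans (∣p*q∣≡∣p∣*∣q∣ (μ i) (M i j)) (cong (_* ∣ M i j ∣) (0≤p⇒∣p∣≡p (0≤μ i)))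

  uniform-bound : ∀ {k c} (f : Fin k → ℚ) → 0ℚ < c → (∀ i → f i < c) →
                  ∃[ ρ ] (0ℚ ≤ ρ × ρ < c × ∀ i → f i ≤ ρ)
  uniform-bound {zero}      f 0<c _   = 0ℚ , ≤-refl , 0<c , λ ()
  uniform-bound {suc k} {c} f 0<c f<c with uniform-bound (f ∘ suc) 0<c (f<c ∘ suc)
  ... | ρ , 0≤ρ , ρ<c , f∘suc≤ρ = f zero ⊔ ρ , ≤-trans 0≤ρ (p≤q⊔p (f zero) ρ) , ⊔<c , f≤⊔
    where
    ⊔<c : f zero ⊔ ρ < c
    ⊔<c with ⊔-sel (f zero) ρ
    ... | inj₁ ⊔≡f0 = subst (_< c) (sym ⊔≡f0) (f<c zero)
    ... | inj₂ ⊔≡ρ  = subst (_< c) (sym ⊔≡ρ) ρ<c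
    f≤⊔ : ∀ i → f i ≤ f zero ⊔ ρ
    f≤⊔ zero    = p≤p⊔q (f zero) ρ
    f≤⊔ (suc i) = ≤-trans (f∘suc≤ρ i) (p≤q⊔p (f zero) ρ)

  ^-nonNeg : ∀ {ρ} → 0ℚ ≤ ρ → ∀ j → 0ℚ ≤ ρ ^ j
  ^-nonNeg 0≤ρ zero    = 0≤1
  ^-nonNeg 0≤ρ (suc j) = *-nonNeg 0≤ρ (^-nonNeg 0≤ρ j)

  bernoulli : ∀ {ρ} → 0ℚ ≤ ρ → ρ ≤ 1ℚ → ∀ j → ρ ^ j * (1ℚ + ℕtoℚ j * (1ℚ - ρ)) ≤ 1ℚ
  bernoulli {ρ} 0≤ρ ρ≤1 zero    = ≤-reflexive (solve 1 (λ r → con 1ℚ :* (con 1ℚ :+ con 0ℚ :* (con 1ℚ :- r)) := con 1ℚ) refl ρ)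
  bernoulli {ρ} 0≤ρ ρ≤1 (suc j) = ≤-trans (≤-reflexive expand) (≤-trans (p-q≤p _ loss≥0) (bernoulli 0≤ρ ρ≤1 j))
    where
    jℚ = ℕtoℚ j
    ε = 1ℚ - ρ
    0≤ε : 0ℚ ≤ ε
    0≤ε = subst (_≤ ε) (+-inverseʳ ρ) (+-monoˡ-≤ (- ρ) ρ≤1)
    loss≥0 : 0ℚ ≤ ρ ^ j * ((1ℚ + jℚ) * (ε * ε))
    loss≥0 = *-nonNeg (^-nonNeg 0≤ρ j) (*-nonNeg (subst (0ℚ ≤_) (ℕtoℚ-+ 1 j) (ℕtoℚ-nonNeg (suc j))) (*-nonNeg 0≤ε 0≤ε))
    expand : ρ * ρ ^ j * (1ℚ + ℕtoℚ (suc j) * ε) ≡ ρ ^ j * (1ℚ + jℚ * ε) - ρ ^ j * ((1ℚ + jℚ) * (ε * ε))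
    expand = trans (cong (λ e → ρ * ρ ^ j * (1ℚ + e * ε)) (ℕtoℚ-+ 1 j))
      (solve 3 (λ r X J → r :* X :* (con 1ℚ :+ (con 1ℚ :+ J) :* (con 1ℚ :- r))
                          := X :* (con 1ℚ :+ J :* (con 1ℚ :- r)) :- X :* ((con 1ℚ :+ J) :* ((con 1ℚ :- r) :* (con 1ℚ :- r)))) refl ρ (ρ ^ j) jℚ)

  archimedean : ∀ q → ∃[ j ] q < ℕtoℚ j
  archimedean q@(mkℚ (ℤ.+ k) d _) = suc k , subst (q <_) (sym (ℕtoℚ≡mkℚ (suc k)))
    (*<* (subst₂ ℤ._<_ (ℤₚ.pos-* k 1) (ℤₚ.pos-* (suc k) (suc d))
      (ℤ.+<+ (subst (ℕ._< suc k ℕ.* suc d) (sym (ℕₚ.*-identityʳ k)) (ℕₚ.m≤m*n (suc k) (suc d))))))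
  archimedean q@(mkℚ ℤ.-[1+ _ ] _ _) = 1 , subst (q <_) (sym (ℕtoℚ≡mkℚ 1)) (*<* ℤ.-<+)

  -- Bernoulli gives C ρʲ (1 + j (1 − ρ)) ≤ C, and the Archimedean property makes C < ε j (1 − ρ).
  ^-vanishes : ∀ {C ε ρ} → 0ℚ ≤ C → 0ℚ < ε → 0ℚ ≤ ρ → ρ < 1ℚ → ∃[ j ] C * ρ ^ j < ε
  ^-vanishes {C} {ε} {ρ} 0≤C 0<ε 0≤ρ ρ<1 = j , *-cancelʳ-<-nonNeg B {{nonNegative 0≤B}} (≤-<-trans CρʲB≤C C<εB)
    where
    η = 1ℚ - ρ
    0<η : 0ℚ < η
    0<η = subst (_< η) (+-inverseʳ ρ) (+-monoˡ-< (- ρ) ρ<1)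
    a = ε * η
    instance
      a-pos : ℚ.Positive a
      a-pos = positive (subst (_< a) (*-zeroˡ η) (*-monoˡ-<-pos η {{positive 0<η}} 0<ε))
      a-nonZero : ℚ.NonZero a
      a-nonZero = pos⇒nonZero a
    j : ℕ
    j = proj₁ (archimedean (C * 1/ a))
    jℚ = ℕtoℚ j
    B = 1ℚ + jℚ * η
    0≤B : 0ℚ ≤ B
    0≤B = +-mono-≤ 0≤1 (*-nonNeg (ℕtoℚ-nonNeg j) (<⇒≤ 0<η))
    C<ja : C < jℚ * a
    C<ja = subst (_< jℚ * a) (trans (*-assoc C (1/ a) a) (trans (cong (C *_) (*-inverseˡ a)) (*-identityʳ C)))
                 (*-monoˡ-<-pos a (proj₂ (archimedean (C * 1/ a))))
    C<εB : C < ε * B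
    C<εB = <-≤-trans C<ja (subst₂ _≤_ (+-identityˡ (jℚ * a)) (solve 3 (λ e J d → e :+ J :* (e :* d) := e :* (con 1ℚ :+ J :* d)) refl ε jℚ η)
                                     (+-monoˡ-≤ (jℚ * a) (<⇒≤ 0<ε)))
    CρʲB≤C : C * ρ ^ j * B ≤ C
    CρʲB≤C = subst₂ _≤_ (sym (*-assoc C (ρ ^ j) B)) (*-identityʳ C) (*-monoˡ-≤ 0≤C (bernoulli 0≤ρ (<⇒≤ ρ<1) j))

module Substochastic {m} (Q : Mat m m) (Q-nonNeg : ∀ i j → 0ℚ ℚ.≤ Q i j) (Q-rowSum≤1 : ∀ i → Σℚ (Q i) ℚ.≤ 1ℚ) where

  open import Data.Rational using (_≤_; _<_; positive)
  open import Algebra.Definitions.RawSemiring ℚ.+-*-rawSemiring using (_^_)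
  open Estimates

  Qⁿ : ℕ → Vect m → Vect m
  Qⁿ zero    g = g
  Qⁿ (suc ℓ) g = Q · Qⁿ ℓ g

  -- survival ℓ i is the probability that the walk started at i is not absorbed within ℓ steps.
  survival : ℕ → Vect m
  survival ℓ = Qⁿ ℓ (const 1ℚ)

  survival-one : ∀ i → survival 1 i ≡ Σℚ (Q i)
  survival-one i = Σ-cong (λ k → *-identityʳ (Q i k))

  ·-mono-≤ : ∀ {g h : Vect m} → (∀ j → g j ≤ h j) → ∀ i → (Q · g) i ≤ (Q · h) i
  ·-mono-≤ g≤h i = Σ-mono-≤ (λ j → *-monoˡ-≤ (Q-nonNeg i j) (g≤h j))

  survival-nonNeg : ∀ ℓ i → 0ℚ ≤ survival ℓ i
  survival-nonNeg zero    i = 0≤1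
  survival-nonNeg (suc ℓ) i = Σ-nonNeg (λ j → *-nonNeg (Q-nonNeg i j) (survival-nonNeg ℓ j))

  survival-suc≤ : ∀ ℓ i → survival (suc ℓ) i ≤ survival ℓ i
  survival-suc≤ zero    i = subst (_≤ 1ℚ) (sym (survival-one i)) (Q-rowSum≤1 i)
  survival-suc≤ (suc ℓ) i = ·-mono-≤ (survival-suc≤ ℓ) i

  survival-≤1 : ∀ ℓ i → survival ℓ i ≤ 1ℚ
  survival-≤1 zero    i = ≤-refl
  survival-≤1 (suc ℓ) i = ≤-trans (survival-suc≤ ℓ i) (survival-≤1 ℓ i)

  survival-suc<1 : ∀ {ℓ i j} → 0ℚ < Q i j → survival ℓ j < 1ℚ → survival (suc ℓ) i < 1ℚ
  survival-suc<1 {ℓ} {i} {j} 0<Qij survival<1 = <-≤-trans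
    (Σ-mono-< (λ k → *-monoˡ-≤ (Q-nonNeg i k) (survival-≤1 ℓ k)) j (*-monoʳ-<-pos (Q i j) {{positive 0<Qij}} survival<1))
    (subst (_≤ 1ℚ) (sym (survival-one i)) (Q-rowSum≤1 i))

  survival-antitone : ∀ {ℓ ℓ′} → ℓ ℕ.≤ ℓ′ → ∀ i → survival ℓ′ i ≤ survival ℓ i
  survival-antitone {ℓ} {ℓ′} ℓ≤ℓ′ i =
    subst (λ t → survival t i ≤ survival ℓ i) (ℕₚ.m∸n+n≡m ℓ≤ℓ′) (drop (ℓ′ ℕ.∸ ℓ))
    where
    drop : ∀ d → survival (d ℕ.+ ℓ) i ≤ survival ℓ i
    drop zero    = ≤-refl
    drop (suc d) = ≤-trans (survival-suc≤ (d ℕ.+ ℓ) i) (drop d)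

  uniform-contraction : (∀ i → ∃[ ℓ ] survival ℓ i < 1ℚ) → ∃[ ℓ ] ∃[ ρ ] (0ℚ ≤ ρ × ρ < 1ℚ × ∀ i → survival ℓ i ≤ ρ)
  uniform-contraction escape = ℓ₀ , uniform-bound (survival ℓ₀) 0<1 survival-ℓ₀<1
    where
    ℓ₀ : ℕ
    ℓ₀ = Σℕ (proj₁ ∘ escape)
    survival-ℓ₀<1 : ∀ i → survival ℓ₀ i < 1ℚ
    survival-ℓ₀<1 i = ≤-<-trans (survival-antitone (≤-Σℕ (proj₁ ∘ escape) i) i) (proj₂ (escape i))

  module Evolution (W : ℕ → Vect m) (W-suc : ∀ K → W (suc K) ≗ W K ᵀ· Q) (W₀-nonNeg : ∀ i → 0ℚ ℚ.≤ W 0 i) where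

    W-nonNeg : ∀ K i → 0ℚ ≤ W K i
    W-nonNeg zero    i = W₀-nonNeg i
    W-nonNeg (suc K) i = subst (0ℚ ≤_) (sym (W-suc K i)) (Σ-nonNeg (λ j → *-nonNeg (W-nonNeg K j) (Q-nonNeg j i)))

    ∙-evolve : ∀ ℓ K g → W (ℓ ℕ.+ K) ∙ g ≡ W K ∙ Qⁿ ℓ g
    ∙-evolve zero    K g = refl
    ∙-evolve (suc ℓ) K g = begin
      W (suc ℓ ℕ.+ K) ∙ g          ≡⟨ cong (λ t → W t ∙ g) (sym (ℕₚ.+-suc ℓ K)) ⟩
      W (ℓ ℕ.+ suc K) ∙ g          ≡⟨ ∙-evolve ℓ (suc K) g ⟩
      W (suc K) ∙ Qⁿ ℓ g           ≡⟨ Σ-cong (λ j → cong (_* Qⁿ ℓ g j) (W-suc K j)) ⟩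
      (W K ᵀ· Q) ∙ Qⁿ ℓ g          ≡⟨ ᵀ·-∙ (W K) Q (Qⁿ ℓ g) ⟩
      W K ∙ Qⁿ (suc ℓ) g           ∎

    mass : ℕ → ℚ
    mass K = Σℚ (W K)

    mass≡∙survival : ∀ ℓ K → mass (ℓ ℕ.+ K) ≡ W K ∙ survival ℓ
    mass≡∙survival ℓ K = trans (Σ-cong (λ u → sym (*-identityʳ (W (ℓ ℕ.+ K) u)))) (∙-evolve ℓ K (const 1ℚ))

    mass-contract : ∀ {ℓ ρ} → (∀ i → survival ℓ i ≤ ρ) → ∀ K → mass (ℓ ℕ.+ K) ≤ ρ * mass K
    mass-contract {ℓ} {ρ} survival≤ρ K =
      subst₂ _≤_ (sym (mass≡∙survival ℓ K)) (trans (sym (*-distribʳ-Σ ρ (W K))) (*-comm (mass K) ρ))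
             (Σ-mono-≤ (λ i → *-monoˡ-≤ (W-nonNeg K i) (survival≤ρ i)))

    mass-antitone : ∀ {K K′} → K ℕ.≤ K′ → mass K′ ≤ mass K
    mass-antitone {K} {K′} K≤K′ = subst (λ t → mass t ≤ mass K) (ℕₚ.m∸n+n≡m K≤K′)
      (subst (mass (K′ ℕ.∸ K ℕ.+ K) ≤_) (*-identityˡ (mass K)) (mass-contract (survival-≤1 (K′ ℕ.∸ K)) K))

    mass-geometric : ∀ {ℓ ρ} → 0ℚ ≤ ρ → (∀ i → survival ℓ i ≤ ρ) → ∀ j → mass (j ℕ.* ℓ) ≤ ρ ^ j * mass 0
    mass-geometric 0≤ρ survival≤ρ zero    = ≤-reflexive (sym (*-identityˡ (mass 0)))
    mass-geometric {ℓ} {ρ} 0≤ρ survival≤ρ (suc j) =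
      ≤-trans (mass-contract survival≤ρ (j ℕ.* ℓ))
              (subst (ρ * mass (j ℕ.* ℓ) ≤_) (sym (*-assoc ρ (ρ ^ j) (mass 0)))
                     (*-monoˡ-≤ 0≤ρ (mass-geometric 0≤ρ survival≤ρ j)))

    mass-vanishes : ∀ {ℓ ρ} → 0ℚ ≤ ρ → ρ < 1ℚ → (∀ i → survival ℓ i ≤ ρ) →
                    ∀ {C ε} → 0ℚ ≤ C → 0ℚ < ε → ∃[ N ] (∀ K → N ℕ.≤ K → mass K * C < ε)
    mass-vanishes {ℓ} {ρ} 0≤ρ ρ<1 survival≤ρ {C} {ε} 0≤C 0<ε = j ℕ.* ℓ , λ K jℓ≤K → ≤-<-trans (bound K jℓ≤K) small
      where
      vanishing : ∃[ j ] mass 0 * C * ρ ^ j < ε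
      vanishing = ^-vanishes (*-nonNeg (Σ-nonNeg W₀-nonNeg) 0≤C) 0<ε 0≤ρ ρ<1
      j : ℕ
      j = proj₁ vanishing
      small : mass 0 * C * ρ ^ j < ε
      small = proj₂ vanishing
      bound : ∀ K → j ℕ.* ℓ ℕ.≤ K → mass K * C ≤ mass 0 * C * ρ ^ j
      bound K jℓ≤K = subst (mass K * C ≤_) (trans (*-assoc (ρ ^ j) (mass 0) C) (*-comm (ρ ^ j) (mass 0 * C)))
        (*-monoʳ-≤ 0≤C (≤-trans (mass-antitone jℓ≤K) (mass-geometric 0≤ρ survival≤ρ j)))

-- Graph Laplacians

deg≡Σ : ∀ {n} (A : Adj n) u → ℕtoℚ (deg A u) ≡ Σℚ (λ w → b2q (A u w))
deg≡Σ A u = trans (ℕtoℚ-Σℕ (λ w → if A u w then 1 else 0)) (Σ-cong (λ w → ℕtoℚ-indicator (A u w)))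
  where
  ℕtoℚ-indicator : ∀ b → ℕtoℚ (if b then 1 else 0) ≡ b2q b
  ℕtoℚ-indicator true  = refl
  ℕtoℚ-indicator false = refl

has-neighbour : ∀ {n} {A : Adj n} {u w} → Reach A u w → u ≢ w → ∃[ x ] A u x ≡ true
has-neighbour here                   u≢u = ⊥-elim (u≢u refl)
has-neighbour (step {w = x} u~x _) _ = x , u~x

module Laplacian {n} (A : Adj n) (symA : Symmetric A) where

  Lap-sym : SymmetricMat (Lap A)
  Lap-sym u w = cong₂ _-_ (trans (δ-weight (ℕtoℚ ∘ deg A) u w) (cong (_* ℕtoℚ (deg A w)) (δ-sym u w)))
                          (cong b2q (symA u w))

  Lap-rowSums : ZeroRowSums (Lap A)
  Lap-rowSums u = begin
    Σℚ (λ w → δ u w * d - b2q (A u w))             ≡⟨ Σ-distrib-- (λ w → δ u w * d) (λ w → b2q (A u w)) ⟩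
    Σℚ (λ w → δ u w * d) - Σℚ (λ w → b2q (A u w))  ≡⟨ cong₂ _-_ (Σ-δˡ u (const d)) (sym (deg≡Σ A u)) ⟩
    d - d                                          ≡⟨ +-inverseʳ d ⟩
    0ℚ                                             ∎
    where d = ℕtoℚ (deg A u)

  Lap-colSums : ZeroRowSums (Lap A ᵀ)
  Lap-colSums w = trans (Σ-cong (λ u → Lap-sym u w)) (Lap-rowSums w)

module GroundedLaplacian {m} (A : Adj (suc m)) (symA : Symmetric A) (v : Fin (suc m))
                         {Y : Mat m m} (inv : IsInverse (delRowCol v (Lap A)) Y) where

  open Laplacian A symA

  L : Mat (suc m) (suc m)
  L = Lap A

  Lᵥ : Mat m m
  Lᵥ = delRowCol v L

  Y-sym : SymmetricMat Y
  Y-sym = inverse-sym (λ i j → Lap-sym (punchIn v i) (punchIn v j)) inv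

  L-zeroSumKernel : ZeroSumKernelTrivial L
  L-zeroSumKernel p Lp≡0 Σp≡0 u = trans (p-constant u) (constant-zeroSum p-constant Σp≡0)
    where
    q : Vect (suc m)
    q u = p u - p v
    Lq≡0 : L · q ≗ const 0ℚ
    Lq≡0 u = trans (·-distrib-- L p (const (p v)) u)
                   (trans (cong₂ _-_ (Lp≡0 u) (·-const≡0 L Lap-rowSums (p v) u)) (+-inverseʳ 0ℚ))
    q-off-v≡0 : ∀ i → q (punchIn v i) ≡ 0ℚ
    q-off-v≡0 i = begin
      q (punchIn v i)              ≡⟨ Id-· (delCoord v q) i ⟨
      (Id · delCoord v q) i        ≡⟨ ·-congˡ (delCoord v q) (proj₂ inv) i ⟨
      ((Y ⊗ Lᵥ) · delCoord v q) i  ≡⟨ ⊗-· Y Lᵥ (delCoord v q) i ⟩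
      (Y · (Lᵥ · delCoord v q)) i  ≡⟨ ·-congʳ Y (λ j → trans (sym (·-punchIn v L q (+-inverseʳ (p v)) j)) (Lq≡0 (punchIn v j))) i ⟩
      (Y · const 0ℚ) i             ≡⟨ trans (·-const Y 0ℚ i) (*-zeroʳ (Σℚ (Y i))) ⟩
      0ℚ                           ∎
    p-constant : ∀ u → p u ≡ p v
    p-constant = punchIn-elim v refl (λ i → p-q≡0⇒p≡q _ _ (q-off-v≡0 i))

  potential : Vect (suc m) → Vect (suc m)
  potential x = center (insertAt (Y · delCoord v x) v 0ℚ)

  L·potential : ∀ x → Σℚ x ≡ 0ℚ → L · potential x ≗ x
  L·potential x Σx≡0 u = trans (·-center L Lap-rowSums y u) (≗-by-delCoord-Σ v {L · y} {x} Σ≡ off-v u)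
    where
    y = insertAt (Y · delCoord v x) v 0ℚ
    Σ≡ : Σℚ (L · y) ≡ Σℚ x
    Σ≡ = trans (Σ-·≡0 L Lap-colSums y) (sym Σx≡0)
    off-v : ∀ i → (L · y) (punchIn v i) ≡ x (punchIn v i)
    off-v i = begin
      (L · y) (punchIn v i)        ≡⟨ ·-punchIn v L y (insertAt-lookup _ v 0ℚ) i ⟩
      (Lᵥ · delCoord v y) i        ≡⟨ ·-congʳ Lᵥ (removeAt-insertAt (Y · delCoord v x) v 0ℚ) i ⟩
      (Lᵥ · (Y · delCoord v x)) i  ≡⟨ ⊗-· Lᵥ Y (delCoord v x) i ⟨
      ((Lᵥ ⊗ Y) · delCoord v x) i  ≡⟨ ·-congˡ (delCoord v x) (proj₁ inv) i ⟩
      (Id · delCoord v x) i        ≡⟨ Id-· (delCoord v x) i ⟩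
      x (punchIn v i)              ∎

  bst≡quadForm : ∀ {Ld} → IsPseudoInverse L Ld → ∀ s t → bst Ld s t ≡ quadForm (suc m) (Y · delCoord v (eDiff s t))
  bst≡quadForm {Ld} pinv s t = begin
    x ∙ ((Ld ⊗ Ld) · x)   ≡⟨ pinv-quadratic {x} {potential z} {z} Lz≗x (L·potential z Σz≡0)
                               (pinv-solution Lap-rowSums L-zeroSumKernel {x} {z} Lz≗x Σz≡0) ⟩
    z ∙ z                 ≡⟨ center-∙ y ⟩
    quadForm (suc m) y    ≡⟨ quadForm-insertAt v (Y · delCoord v x) ⟩
    quadForm (suc m) (Y · delCoord v x)  ∎
    where
    open PseudoInverse Lap-sym pinv
    x = eDiff s t
    y = insertAt (Y · delCoord v x) v 0ℚ
    z = potential x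
    Lz≗x : L · z ≗ x
    Lz≗x = L·potential x (Σ-eDiff s t)
    Σz≡0 : Σℚ z ≡ 0ℚ
    Σz≡0 = Σ-center y

  module AbsorbedWalk (conn : Connected A) where

    open import Data.Rational using (_≤_; _<_; ∣_∣)
    open Estimates

    d : Fin m → ℕ
    d i = deg A (punchIn v i)

    Q : Mat m m
    Q w u = b2q (A (punchIn v w) (punchIn v u)) * recip (d w)

    τ : Fin (suc m) → Vect m
    τ s = Y · delCoord v (δ s)

    instance
      d-nonZero : ∀ {i} → ℕ.NonZero (d i)
      d-nonZero {i} with has-neighbour (conn (punchIn v i) v) (punchInᵢ≢i v i)
      ... | x , i~x = ℕ.>-nonZero (subst (ℕ._≤ d i) (cong (λ b → if b then 1 else 0) i~x)
                                         (≤-Σℕ (λ w → if A (punchIn v i) w then 1 else 0) x))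

    Q-nonNeg : ∀ i j → 0ℚ ≤ Q i j
    Q-nonNeg i j = *-nonNeg (b2q-nonNeg (A (punchIn v i) (punchIn v j))) (recip-nonNeg (d i))

    Q-rowSum : ∀ i → Σℚ (Q i) ≡ 1ℚ - b2q (A (punchIn v i) v) * recip (d i)
    Q-rowSum i = begin
      Σℚ (Q i)                ≡⟨ *-distribʳ-Σ r (λ j → b2q (A (punchIn v i) (punchIn v j))) ⟨
      S * r                   ≡⟨ cong (_* r) (solve 2 (λ S b → S := (b :+ S) :- b) refl S b) ⟩
      ((b + S) - b) * r       ≡⟨ cong (λ e → (e - b) * r) (sym (trans (deg≡Σ A (punchIn v i)) (Σ-punchIn v (λ w → b2q (A (punchIn v i) w))))) ⟩
      (ℕtoℚ (d i) - b) * r    ≡⟨ solve 3 (λ D b r → (D :- b) :* r := r :* D :- b :* r) refl (ℕtoℚ (d i)) b r ⟩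
      r * ℕtoℚ (d i) - b * r  ≡⟨ cong (_- b * r) (recip-inverseˡ (d i)) ⟩
      1ℚ - b * r              ∎
      where
      b = b2q (A (punchIn v i) v)
      r = recip (d i)
      S = Σℚ (λ j → b2q (A (punchIn v i) (punchIn v j)))

    Q-rowSum≤1 : ∀ i → Σℚ (Q i) ≤ 1ℚ
    Q-rowSum≤1 i = subst (_≤ 1ℚ) (sym (Q-rowSum i)) (p-q≤p 1ℚ (*-nonNeg (b2q-nonNeg (A (punchIn v i) v)) (recip-nonNeg (d i))))

    open Substochastic Q Q-nonNeg Q-rowSum≤1

    Q-pos : ∀ {i j} → A (punchIn v i) (punchIn v j) ≡ true → 0ℚ < Q i j
    Q-pos {i} edge = subst (λ b → 0ℚ < b2q b * recip (d i)) (sym edge)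
                           (subst (0ℚ <_) (sym (*-identityˡ (recip (d i)))) (recip-pos (d i)))

    Q-rowSum<1 : ∀ {i} → A (punchIn v i) v ≡ true → Σℚ (Q i) < 1ℚ
    Q-rowSum<1 {i} edge = subst (_< 1ℚ) (sym (Q-rowSum i))
      (subst (λ b → 1ℚ - b2q b * recip (d i) < 1ℚ) (sym edge)
        (subst (λ e → 1ℚ - e < 1ℚ) (sym (*-identityˡ (recip (d i)))) (p-q<p 1ℚ (recip-pos (d i)))))

    -- Along a path to v: its last vertex leaks mass into v, and survival < 1 propagates backwards along edges.
    escape : ∀ i → ∃[ ℓ ] survival ℓ i < 1ℚ
    escape i = along (conn (punchIn v i) v) refl
      where
      along : ∀ {x} → Reach A x v → ∀ {i} → x ≡ punchIn v i → ∃[ ℓ ] survival ℓ i < 1ℚ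
      along here {i} v≡i = ⊥-elim (punchInᵢ≢i v i (sym v≡i))
      along (step {w = y} x~y y↝v) {i} refl = next (v ≟ y) x~y (along y↝v)
        where
        next : Dec (v ≡ y) → A (punchIn v i) y ≡ true → (∀ {j} → y ≡ punchIn v j → ∃[ ℓ ] survival ℓ j < 1ℚ) →
               ∃[ ℓ ] survival ℓ i < 1ℚ
        next (yes refl) i~v _ = 1 , subst (_< 1ℚ) (sym (survival-one i)) (Q-rowSum<1 i~v)
        next (no v≢y) i~y rec = map suc (λ {ℓ} → survival-suc<1 {ℓ} {i} {j} (Q-pos {i} {j} i~j)) (rec {j} (sym (punchIn-punchOut v≢y)))
          where
          j = punchOut v≢y
          i~j = trans (cong (A (punchIn v i)) (punchIn-punchOut v≢y)) i~y

    -- Lᵥ = Dᵥ (I − Q), so (Dᵥ⁻¹ μ)ᵀ = (μ − μ Q)ᵀ Lᵥ⁻¹.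
    resolvent : ∀ (μ : Vect m) u → recip (d u) * μ u ≡ ((λ j → μ j - (μ ᵀ· Q) j) ᵀ· Y) u
    resolvent μ u = begin
      a u                                   ≡⟨ ᵀ·-Id a u ⟨
      (a ᵀ· Id) u                           ≡⟨ Σ-cong (λ k → cong (a k *_) (sym (proj₁ inv k u))) ⟩
      (a ᵀ· (Lᵥ ⊗ Y)) u                     ≡⟨ ᵀ·-⊗ a Lᵥ Y u ⟩
      ((a ᵀ· Lᵥ) ᵀ· Y) u                    ≡⟨ Σ-cong (λ j → cong (_* Y j u) (aLᵥ j)) ⟩
      ((λ j → μ j - (μ ᵀ· Q) j) ᵀ· Y) u     ∎
      where
      a : Vect m
      a j = recip (d j) * μ j
      aLᵥ-entry : ∀ j k → a j * Lᵥ j k ≡ μ j * δ j k - μ j * Q j k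
      aLᵥ-entry j k = begin
        a j * (δ (punchIn v j) (punchIn v k) * D - b)  ≡⟨ cong (λ e → a j * (e * D - b)) (δ-injective (punchIn v) (punchIn-injective v _ _) j k) ⟩
        r * μ j * (δ j k * D - b)
          ≡⟨ solve 5 (λ r μ δ D b → r :* μ :* (δ :* D :- b) := (r :* D) :* (μ :* δ) :- μ :* (b :* r)) refl r (μ j) (δ j k) D b ⟩
        (r * D) * (μ j * δ j k) - μ j * Q j k           ≡⟨ cong (λ e → e * (μ j * δ j k) - μ j * Q j k) (recip-inverseˡ (d j)) ⟩
        1ℚ * (μ j * δ j k) - μ j * Q j k                ≡⟨ cong (_- μ j * Q j k) (*-identityˡ (μ j * δ j k)) ⟩
        μ j * δ j k - μ j * Q j k                       ∎
        where
        r = recip (d j)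
        D = ℕtoℚ (d j)
        b = b2q (A (punchIn v j) (punchIn v k))
      aLᵥ : ∀ k → (a ᵀ· Lᵥ) k ≡ μ k - (μ ᵀ· Q) k
      aLᵥ k = trans (Σ-cong (λ j → aLᵥ-entry j k))
                    (trans (Σ-distrib-- (λ j → μ j * δ j k) (λ j → μ j * Q j k)) (cong (_- (μ ᵀ· Q) k) (Σ-δʳ k μ)))

    normalizedVisits : ∀ s K u → recip (d u) * partialVisits A v s K u ≡ τ s u - (walkDist A v s K ᵀ· Y) u
    normalizedVisits s zero u = trans (*-zeroʳ (recip (d u))) (sym (trans (cong (λ e → τ s u - e) W₀ᵀ·Y≡τ) (+-inverseʳ (τ s u))))
      where
      W₀ᵀ·Y≡τ : (walkDist A v s 0 ᵀ· Y) u ≡ τ s u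
      W₀ᵀ·Y≡τ = Σ-cong (λ j → trans (*-comm (δ s (punchIn v j)) (Y j u)) (cong (_* δ s (punchIn v j)) (Y-sym j u)))
    normalizedVisits s (suc K) u = begin
      r * (partialVisits A v s K u + W u)          ≡⟨ *-distribˡ-+ r (partialVisits A v s K u) (W u) ⟩
      r * partialVisits A v s K u + r * W u        ≡⟨ cong₂ _+_ (normalizedVisits s K u) (trans (resolvent W u) (ᵀ·-distrib-- W (W ᵀ· Q) Y u)) ⟩
      (τ s u - (W ᵀ· Y) u) + ((W ᵀ· Y) u - ((W ᵀ· Q) ᵀ· Y) u)
                                                   ≡⟨ solve 3 (λ t e f → (t :- e) :+ (e :- f) := t :- f) refl (τ s u) _ _ ⟩
      τ s u - ((W ᵀ· Q) ᵀ· Y) u                    ∎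
      where
      r = recip (d u)
      W = walkDist A v s K

    visits-converge : IsNormVisitVector A v τ
    visits-converge s u = converge (uniform-contraction escape)
      where
      open Evolution (walkDist A v s) (λ _ _ → refl) (λ j → δ-nonNeg s (punchIn v j))
      error≡ : ∀ K → ∣ recip (d u) * partialVisits A v s K u - τ s u ∣ ≡ ∣ (walkDist A v s K ᵀ· Y) u ∣
      error≡ K = trans (cong (λ x → ∣ x - τ s u ∣) (normalizedVisits s K u))
                       (trans (cong ∣_∣ (solve 2 (λ t e → (t :- e) :- t := :- e) refl (τ s u) e)) (∣-p∣≡∣p∣ e))
        where e = (walkDist A v s K ᵀ· Y) u
      converge : ∃[ ℓ ] ∃[ ρ ] (0ℚ ≤ ρ × ρ < 1ℚ × ∀ i → survival ℓ i ≤ ρ) →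
                 ConvergesTo (λ K → recip (d u) * partialVisits A v s K u) (τ s u)
      converge (ℓ , ρ , 0≤ρ , ρ<1 , survival≤ρ) ε 0<ε =
        map₂ (λ small K N≤K → subst (_< ε) (sym (error≡ K)) (≤-<-trans (∣ᵀ·∣≤ (W-nonNeg K) Y u) (small K N≤K)))
             (mass-vanishes {ℓ} 0≤ρ ρ<1 survival≤ρ (Σ-nonNeg (λ j → 0≤∣p∣ (Y j u))) 0<ε)

open import Data.Nat using (ℕ; suc; _≤_)
open import Data.Fin using (Fin)
open import Data.Rational using (ℚ; _-_)
open import Data.Product using (_×_; ∃-syntax)
open import Relation.Binary.PropositionalEquality using (_≡_)

lemma3p2 : (m : ℕ) → 1 ≤ m → (A : Adj (suc m)) → Symmetric A → Loopless A → Connected A →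
    (Ld : Mat (suc m) (suc m)) → IsPseudoInverse (Lap A) Ld →
    (v : Fin (suc m)) → (Lvinv : Mat m m) → IsInverse (delRowCol v (Lap A)) Lvinv →
    (∀ s t → bst Ld s t ≡ quadForm (suc m) (Lvinv · delCoord v (eDiff s t)))
    × (∃[ τ ] (IsNormVisitVector A v τ
        × (∀ s t → bst Ld s t ≡ quadForm (suc m) (λ u → τ s u - τ t u))))
lemma3p2 m _ A symA _ conn Ld pinv v Y inv = bst≡quadForm pinv , τ , visits-converge , bst≡quadForm-τ
  where
  open GroundedLaplacian A symA v inv using (bst≡quadForm; module AbsorbedWalk)
  open AbsorbedWalk conn using (τ; visits-converge)
  bst≡quadForm-τ : ∀ s t → bst Ld s t ≡ quadForm (suc m) (λ u → τ s u - τ t u)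
  bst≡quadForm-τ s t = trans (bst≡quadForm pinv s t) (quadForm-cong (suc m) (·-distrib-- Y (delCoord v (δ s)) (delCoord v (δ t))))
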